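{- Let $A$ be a finite abelian group of order $n$ that is not an elementary abelian $2$-group, and let $D(A)=\langle x, A \mid x^2=1,\ xax=a^{ -1} \text{ for all } a\in A\rangle$ be the generalised dihedral group over $A$. Consider the following two faithful transitive permutation actions of $D(A)$: (1) the regular action of $D(A)$ on itself by left multiplication (degree $2n$), and (2) the action of $D(A)$ by left multiplication on the set $D(A)/H$ of left cosets of $H=\langle x\rangle$ (degree $n$). In each of these two actions, $D(A)$ has the EKR property and is EKR robust.
   Context: For a finite transitive permutation group $G$ of degree $m$ acting on a set $\Omega$: a derangement is an element of $G$ with no fixed point in $\Omega$; $\mathrm{Der}(G)$ is the set of derangements. For an inverse-closed $S\subseteq G$ not containing the identity, $\mathrm{Cay}(G,S)$ is the graph with vertex set $G$ in which $g,h$ are adjacent iff $g^{ -1}h\in S$. The derangement graph is $\Gamma_G=\mathrm{Cay}(G,\mathrm{Der}(G))$; $\alpha(\cdot)$ denotes independence number. $G$ has the EKR property if $\alpha(\Gamma_G)=|G|/m$. A label is a set $\{d,d^{ -1}\}$ with $d\in\mathrm{Der}(G)$; the number of labels of a set $D\subseteq \mathrm{Der}(G)$ is $|\{\{d,d^{ -1}\}: d\in D\}|$. For $i\ne j$ in $\Omega$ let $D_{i\to j}=\{d\in\mathrm{Der}(G): d(i)=j\}$, and let $\mathbf{d}_G=\min_{i\neq j}|\{\{d,d^{ -1}\}: d\in D_{i\to j}\}|$. $G$ is EKR robust if $\alpha(\mathrm{Cay}(G,\mathrm{Der}(G)\setminus D))=|G|/m$ for every inverse-closed $D\subseteq\mathrm{Der}(G)$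 having fewer than $\mathbf{d}_G$ labels. -}

module Defs where

open import Level using (Level; _⊔_)
open import Algebra.Bundles using (AbelianGroup)
open import Algebra.Bundles.Raw using (RawGroup)
open import Data.Bool using (Bool; true; false; _xor_; if_then_else_)
open import Data.Product using (Σ; ∃; _×_; _,_; proj₁)
open import Data.Sum using (_⊎_)
open import Data.List using (List; length)
open import Data.List.Relation.Unary.All using (All)
open import Data.List.Relation.Unary.Any using (Any)
open import Data.List.Relation.Unary.AllPairs using (AllPairs)
open import Data.Nat using (ℕ; _<_; _≤_; _*_)
open import Relation.Nullary using (¬_)
open import Relation.Binary.PropositionalEquality using (_≡_)

record Enumeration {a r : Level} {A : Set a} (_≈_ : A → A → Set r) : Set (a ⊔ r) where
  field
    elems    : List A
    distinct : AllPairs (λ x y → ¬ (x ≈ y)) elems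
    complete : ∀ x → Any (x ≈_) elems

  size : ℕ
  size = length elems

open Enumeration public

record Action {c ℓ : Level} (G : RawGroup c ℓ) (o r : Level) : Set (c ⊔ ℓ ⊔ Level.suc (o ⊔ r)) where
  field
    Point : Set o
    _≈ₚ_  : Point → Point → Set r
    act   : RawGroup.Carrier G → Point → Point

module ActionNotions {c ℓ o r : Level} {G : RawGroup c ℓ} (Act : Action G o r) where
  open RawGroup G
  open Action Act

  Der : Carrier → Set (o ⊔ r)
  Der g = ∀ ω → ¬ (act g ω ≈ₚ ω)

  Dto : Point → Point → Carrier → Set (o ⊔ r)
  Dto i j g = Der g × (act g i ≈ₚ j)

  -- independent sets of Cay(G,S): distinct elements, no two adjacent
  -- (g ~ h iff g⁻¹h ∈ S; both orders required)
  Independent : ∀ {s} → (Carrier → Set s) → List Carrier → Set (c ⊔ ℓ ⊔ s)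
  Independent S xs =
    AllPairs (λ g h → ¬ (g ≈ h) × ¬ S (g ⁻¹ ∙ h) × ¬ S (h ⁻¹ ∙ g)) xs

  IndependenceNumber : ∀ {s} → (Carrier → Set s) → ℕ → Set (c ⊔ ℓ ⊔ s)
  IndependenceNumber S k =
    (Σ (List Carrier) λ xs → Independent S xs × length xs ≡ k)
    × (∀ xs → Independent S xs → length xs ≤ k)

  -- the set P ⊆ G has exactly k labels {d, d⁻¹}: a list of k elements of P
  -- with pairwise distinct labels, whose labels cover every element of P
  NumLabels : ∀ {s} → (Carrier → Set s) → ℕ → Set (c ⊔ ℓ ⊔ s)
  NumLabels P k =
    Σ (List Carrier) λ reps →
      length reps ≡ k
      × All P reps
      × AllPairs (λ a b → ¬ (a ≈ b) × ¬ (a ≈ b ⁻¹)) reps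
      × (∀ g → P g → Any (λ d → g ≈ d ⊎ g ≈ d ⁻¹) reps)

  -- EKR property: α(Γ_G) = |G|/m  (written as α·m = |G|),
  -- where |G| and m = |Ω| are the sizes of any enumerations.
  EKR : Set (c ⊔ ℓ ⊔ o ⊔ r)
  EKR = (eG : Enumeration _≈_) (eΩ : Enumeration _≈ₚ_) →
        Σ ℕ λ k → k * size eΩ ≡ size eG × IndependenceNumber Der k

  InvClosedDerSubset : (Carrier → Bool) → Set (c ⊔ ℓ ⊔ o ⊔ r)
  InvClosedDerSubset D =
    (∀ g h → g ≈ h → D g ≡ D h)
    × (∀ g → D g ≡ true → Der g)
    × (∀ g → D g ≡ true → D (g ⁻¹) ≡ true)

  -- D has fewer than d_G = min_{i≠j} #labels(D_{i→j}) labels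
  FewerThanDG : (Carrier → Bool) → Set (c ⊔ ℓ ⊔ o ⊔ r)
  FewerThanDG D =
    Σ ℕ λ kD → NumLabels (λ g → D g ≡ true) kD
      × (∀ i j → ¬ (i ≈ₚ j) → ∀ k → NumLabels (Dto i j) k → kD < k)

  EKRRobust : Set (c ⊔ ℓ ⊔ o ⊔ r)
  EKRRobust = (eG : Enumeration _≈_) (eΩ : Enumeration _≈ₚ_) →
    Σ ℕ λ k → k * size eΩ ≡ size eG ×
      (∀ (D : Carrier → Bool) → InvClosedDerSubset D → FewerThanDG D →
         IndependenceNumber (λ g → Der g × D g ≡ false) k)

-- The generalised dihedral group D(A) = A ⋊ ⟨x⟩, realised as A × Bool:
-- (a , false) ↔ a,  (a , true) ↔ a x.
-- (a,s)(b,t) = (a · b^{±1}, s xor t), with b⁻¹ used iff s = true.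

module _ {c ℓ : Level} (A : AbelianGroup c ℓ) where
  private module A = AbelianGroup A

  GenDihedral : RawGroup c ℓ
  GenDihedral = record
    { Carrier = A.Carrier × Bool
    ; _≈_     = λ { (a , s) (b , t) → (a A.≈ b) × (s ≡ t) }
    ; _∙_     = λ { (a , s) (b , t) → (a A.∙ (if s then b A.⁻¹ else b)) , (s xor t) }
    ; ε       = A.ε , false
    ; _⁻¹     = λ { (a , s) → (if s then a else a A.⁻¹) , s }
    }

  regularAction : Action GenDihedral c ℓ
  regularAction = record
    { Point = RawGroup.Carrier GenDihedral
    ; _≈ₚ_  = RawGroup._≈_ GenDihedral
    ; act   = RawGroup._∙_ GenDihedral
    }

  InH : RawGroup.Carrier GenDihedral → Set ℓ
  InH (a , _) = a A.≈ A.ε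

  -- (2) action on left cosets of H: points are representatives g, with
  -- gH = hH  iff  g⁻¹h ∈ H; action by left multiplication
  cosetAction : Action GenDihedral c ℓ
  cosetAction = record
    { Point = RawGroup.Carrier GenDihedral
    ; _≈ₚ_  = λ g h → InH (RawGroup._∙_ GenDihedral (RawGroup._⁻¹ GenDihedral g) h)
    ; act   = RawGroup._∙_ GenDihedral
    }

  ElementaryAbelian2 : Set (c ⊔ ℓ)
  ElementaryAbelian2 = ∀ a → (a A.∙ a) A.≈ A.ε

-- In the regular action every g ≠ 1 is a derangement, so the derangement graph is complete and
-- α = 1 = 2n/2n.  In the action on G/⟨x⟩ (cosets aH ↔ a ∈ A) every rotation a ≠ 1 is a
-- derangement, so the two cosets A and Ax of A in D(A) are cliques, while {1, x} is independent
-- because x fixes H: α = 2 = 2n/n.  Robustness holds because some D_{i→j} has a single label,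
-- so d_G ≤ 1 and only D = ∅ has fewer than d_G labels.  In the regular action every D_{i→j} is a
-- single element.  In the coset action pick a with a² ≠ 1 (A is not an elementary abelian
-- 2-group): the only elements mapping H to a²H are the rotation a² and the reflection a²x, and
-- the latter fixes aH.
module Submission where

open import Defs
open import Algebra.Bundles using (AbelianGroup; Group)
open import Algebra.Bundles.Raw using (RawGroup)
import Algebra.Properties.Group as GroupProperties
import Algebra.Properties.Monoid as MonoidProperties
open import Level using (Level)
open import Function using (_∘_)
open import Data.Bool using (Bool; true; false)
open import Data.Bool.Properties using (¬-not; not-¬)
open import Data.Empty using (⊥-elim)
open import Data.Product using (_×_; _,_; proj₁; proj₂)
open import Data.Product.Relation.Binary.Pointwise.NonDependent using (×-setoid)
open import Data.Sum using (_⊎_; inj₁; inj₂; [_,_]′)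
open import Data.List using ([]; _∷_; length; map; _++_)
open import Data.List.Properties using (length-map; length-++)
import Data.List.Fresh as List#
import Data.List.Fresh.Relation.Unary.Any as Any#
import Data.List.Fresh.Membership.Setoid.Properties as FreshMembership
open import Data.List.Relation.Unary.All as All using (All; []; _∷_)
import Data.List.Relation.Unary.All.Properties as All
open import Data.List.Relation.Unary.Any as Any using (Any; here; there)
import Data.List.Relation.Unary.Any.Properties as Any
open import Data.List.Relation.Unary.AllPairs as AllPairs using (AllPairs; []; _∷_)
import Data.List.Relation.Unary.AllPairs.Properties as AllPairs
open import Data.Nat using (suc; _+_; _≤_; _*_; z≤n; s≤s)
open import Data.Nat.Properties using (≤-antisym; ≤⇒≯; *-identityˡ; +-identityʳ)
open import Relation.Nullary using (¬_)
open import Relation.Nullary.Decidable using (decidable-stable)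
open import Relation.Binary.Bundles using (Setoid)
open import Relation.Binary.Definitions using (Decidable)
open import Relation.Binary.PropositionalEquality as ≡ using (_≡_; refl)

module _ {g ℓ} (G : Group g ℓ) where
  open Group G
  open GroupProperties G using (⁻¹-injective; inverseˡ-unique)

  x⁻¹∙y≈ε⇒x≈y : ∀ x y → x ⁻¹ ∙ y ≈ ε → x ≈ y
  x⁻¹∙y≈ε⇒x≈y x y eq = ⁻¹-injective (inverseˡ-unique (x ⁻¹) y eq)

  x≈y⇒x⁻¹∙y≈ε : ∀ {x y} → x ≈ y → x ⁻¹ ∙ y ≈ ε
  x≈y⇒x⁻¹∙y≈ε {x} x≈y = trans (∙-congˡ (sym x≈y)) (inverseˡ x)

module _ {a r} {X : Set a} {R : X → X → Set r} where

  length-fromList : ∀ {xs} (rs : AllPairs R xs) → List#.length (List#.fromList rs) ≡ length xs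
  length-fromList []       = refl
  length-fromList (_ ∷ rs) = ≡.cong suc (length-fromList rs)

  any-fromList : ∀ {p} {P : X → Set p} {xs} (rs : AllPairs R xs) →
                 Any P xs → Any#.Any P (List#.fromList rs)
  any-fromList (_ ∷ _)  (here px)  = Any#.here px
  any-fromList (_ ∷ rs) (there px) = Any#.there (any-fromList rs px)

module _ {a ℓ} (S : Setoid a ℓ) where
  open Setoid S using (_≈_)

  enumeration-size-≤ : (e₁ e₂ : Enumeration _≈_) → size e₁ ≤ size e₂
  enumeration-size-≤ e₁ e₂ =
    ≡.subst₂ _≤_ (length-fromList (distinct e₁)) (length-fromList (distinct e₂))
      (FreshMembership.injection S (λ x≉y → x≉y)
        (λ {x} _ → any-fromList (distinct e₂) (complete e₂ x)))

  enumeration-size-unique : (e₁ e₂ : Enumeration _≈_) → size e₁ ≡ size e₂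
  enumeration-size-unique e₁ e₂ = ≤-antisym (enumeration-size-≤ e₁ e₂) (enumeration-size-≤ e₂ e₁)

  ×-Bool-enumeration : Enumeration _≈_ → Enumeration (Setoid._≈_ (×-setoid S (≡.setoid Bool)))
  ×-Bool-enumeration e = record
    { elems    = map (_, false) (elems e) ++ map (_, true) (elems e)
    ; distinct = AllPairs.++⁺ (layer (distinct e)) (layer (distinct e)) (layersDisjoint (elems e))
    ; complete = λ where
        (x , false) → Any.++⁺ˡ (inLayer (complete e x))
        (x , true)  → Any.++⁺ʳ (map (_, false) (elems e)) (inLayer (complete e x))
    }
    where
    layer : ∀ {b xs} → AllPairs (λ x y → ¬ x ≈ y) xs →
            AllPairs (λ p q → ¬ (proj₁ p ≈ proj₁ q × proj₂ p ≡ proj₂ q)) (map (_, b) xs)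
    layer = AllPairs.map⁺ ∘ AllPairs.map (_∘ proj₁)

    layersDisjoint : ∀ xs → All (λ p → All (λ q → ¬ (proj₁ p ≈ proj₁ q × proj₂ p ≡ proj₂ q))
                                          (map (_, true) xs)) (map (_, false) xs)
    layersDisjoint xs =
      All.map⁺ (All.universal (λ _ → All.map⁺ (All.universal (λ _ → λ { (_ , ()) }) xs)) xs)

    inLayer : ∀ {x b xs} → Any (x ≈_) xs → Any (λ q → x ≈ proj₁ q × b ≡ proj₂ q) (map (_, b) xs)
    inLayer = Any.map⁺ ∘ Any.map (_, refl)

  size-×-Bool-enumeration : (e : Enumeration _≈_) → size (×-Bool-enumeration e) ≡ 2 * size e
  size-×-Bool-enumeration e = begin
    length (map (_, false) (elems e) ++ map (_, true) (elems e))
      ≡⟨ length-++ (map (_, false) (elems e)) ⟩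
    length (map (_, false) (elems e)) + length (map (_, true) (elems e))
      ≡⟨ ≡.cong₂ _+_ (length-map (_, false) (elems e)) (length-map (_, true) (elems e)) ⟩
    size e + size e
      ≡⟨ ≡.cong (size e +_) (≡.sym (+-identityʳ (size e))) ⟩
    2 * size e ∎
    where open ≡.≡-Reasoning

three-Bools-collide : (x y z : Bool) → x ≡ y ⊎ x ≡ z ⊎ y ≡ z
three-Bools-collide false false _     = inj₁ refl
three-Bools-collide true  true  _     = inj₁ refl
three-Bools-collide false true  false = inj₂ (inj₁ refl)
three-Bools-collide true  false true  = inj₂ (inj₁ refl)
three-Bools-collide false true  true  = inj₂ (inj₂ refl)
three-Bools-collide true  false false = inj₂ (inj₂ refl)

module _ {c ℓ o r} {G : RawGroup c ℓ} (Act : Action G o r) where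
  open RawGroup G
  open Action Act using (_≈ₚ_)
  open ActionNotions Act

  private
    variable
      s s′ : Level
      S : Carrier → Set s
      S′ : Carrier → Set s′

  independent-anti : (∀ {g} → S′ g → S g) → ∀ {xs} → Independent S xs → Independent S′ xs
  independent-anti S′⊆S = AllPairs.map λ {g} {h} (g≉h , ¬Sgh , ¬Shg) →
    g≉h , ¬Sgh ∘ S′⊆S {g ⁻¹ ∙ h} , ¬Shg ∘ S′⊆S {h ⁻¹ ∙ g}

  independenceNumber-cong : (∀ {g} → S g → S′ g) → (∀ {g} → S′ g → S g) →
                            ∀ {k} → IndependenceNumber S k → IndependenceNumber S′ k
  independenceNumber-cong {S = S} {S′ = S′} S⊆S′ S′⊆S
                          ((xs , independent , length≡k) , maximal) =
      (xs , independent-anti {S = S} S′⊆S independent , length≡k)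
    , λ ys → maximal ys ∘ independent-anti {S = S′} S⊆S′

  clique⇒independenceNumber-1 : (∀ g h → ¬ g ≈ h → S (g ⁻¹ ∙ h)) → IndependenceNumber S 1
  clique⇒independenceNumber-1 {S = S} adjacent = (ε ∷ [] , [] ∷ [] , refl) , maximal
    where
    maximal : ∀ xs → Independent S xs → length xs ≤ 1
    maximal []          _                       = z≤n
    maximal (_ ∷ [])    _                       = s≤s z≤n
    maximal (g ∷ h ∷ _) ((nonadjacent ∷ _) ∷ _) =
      ⊥-elim (proj₁ (proj₂ nonadjacent) (adjacent g h (proj₁ nonadjacent)))

  twoCliques⇒independenceNumber-2 :
    (colour : Carrier → Bool) → (∀ g h → colour g ≡ colour h → ¬ g ≈ h → S (g ⁻¹ ∙ h)) →
    ∀ {g₀ g₁} → Independent S (g₀ ∷ g₁ ∷ []) → IndependenceNumber S 2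
  twoCliques⇒independenceNumber-2 {S = S} colour adjacent {g₀} {g₁} independent =
    (g₀ ∷ g₁ ∷ [] , independent , refl) , maximal
    where
    nonadjacent⇒colours≢ : ∀ {g h} → ¬ g ≈ h × ¬ S (g ⁻¹ ∙ h) × ¬ S (h ⁻¹ ∙ g) →
                           ¬ colour g ≡ colour h
    nonadjacent⇒colours≢ {g} {h} (g≉h , ¬S , _) same = ¬S (adjacent g h same g≉h)

    maximal : ∀ xs → Independent S xs → length xs ≤ 2
    maximal []                  _ = z≤n
    maximal (_ ∷ [])            _ = s≤s z≤n
    maximal (_ ∷ _ ∷ [])        _ = s≤s (s≤s z≤n)
    maximal (h₁ ∷ h₂ ∷ h₃ ∷ _) ((p₁₂ ∷ p₁₃ ∷ _) ∷ (p₂₃ ∷ _) ∷ _) =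
      ⊥-elim ([ nonadjacent⇒colours≢ p₁₂
              , [ nonadjacent⇒colours≢ p₁₃ , nonadjacent⇒colours≢ p₂₃ ]′
              ]′ (three-Bools-collide (colour h₁) (colour h₂) (colour h₃)))

  singleton-numLabels : ∀ {d} → S d → (∀ g → S g → g ≈ d) → NumLabels S 1
  singleton-numLabels {d = d} Sd unique =
    d ∷ [] , refl , Sd ∷ [] , [] ∷ [] , λ g Sg → here (inj₁ (unique g Sg))

  numLabels-positive : ∀ {k g} → NumLabels S k → S g → 1 ≤ k
  numLabels-positive (_ ∷ _ , refl , _) _ = s≤s z≤n
  numLabels-positive ([] , refl , _ , _ , cover) Sg with () ← cover _ Sg

  singleLabel⇒fewerThanDG-empty : ∀ {i j} → ¬ i ≈ₚ j → NumLabels (Dto i j) 1 →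
                                  ∀ {D} → FewerThanDG D → ∀ g → D g ≡ false
  singleLabel⇒fewerThanDG-empty i≉j single (_ , labels , fewer) g =
    ¬-not λ Dg → ≤⇒≯ (numLabels-positive labels Dg) (fewer _ _ i≉j 1 single)

  EKR⇒EKRRobust : (∀ D → InvClosedDerSubset D → FewerThanDG D → ∀ g → D g ≡ false) →
                  EKR → EKRRobust
  EKR⇒EKRRobust onlyEmpty ekr eG eΩ =
    let k , degree , α = ekr eG eΩ in
    k , degree , λ D closed fewer →
      independenceNumber-cong {S = Der} {S′ = λ g → Der g × D g ≡ false}
        (λ der → der , onlyEmpty D closed fewer _) proj₁ α

module GeneralisedDihedral {c ℓ} (A : AbelianGroup c ℓ) where
  private
    module A where
      open AbelianGroup A public
      open GroupProperties group public using (ε⁻¹≈ε; identityˡ-unique; x∙y⁻¹≈ε⇒x≈y; x≈y⇒x∙y⁻¹≈ε)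
      open MonoidProperties monoid public using (cancelʳ)

  open RawGroup (GenDihedral A)
  open Action (cosetAction A) using () renaming (_≈ₚ_ to infix 4 _≈H_)
  module Reg = ActionNotions (regularAction A)
  module Cos = ActionNotions (cosetAction A)

  dihedralSetoid : Setoid c ℓ
  dihedralSetoid = ×-setoid A.setoid (≡.setoid Bool)

  open Setoid dihedralSetoid using () renaming (sym to ≈-sym; trans to ≈-trans)

  ∙-identityʳ : ∀ g → g ∙ ε ≈ g
  ∙-identityʳ (a , false) = A.identityʳ a , refl
  ∙-identityʳ (a , true)  = A.trans (A.∙-congˡ A.ε⁻¹≈ε) (A.identityʳ a) , refl

  ⁻¹∙≈ε⇒≈ : ∀ g h → g ⁻¹ ∙ h ≈ ε → g ≈ h
  ⁻¹∙≈ε⇒≈ (a , false) (b , false) (eq , _) = x⁻¹∙y≈ε⇒x≈y A.group a b eq , refl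
  ⁻¹∙≈ε⇒≈ (a , true)  (b , true)  (eq , _) = A.x∙y⁻¹≈ε⇒x≈y a b eq , refl
  ⁻¹∙≈ε⇒≈ (a , false) (b , true)  (_ , ())
  ⁻¹∙≈ε⇒≈ (a , true)  (b , false) (_ , ())

  regular-fixedPoint⇒≈ε : ∀ g ω → g ∙ ω ≈ ω → g ≈ ε
  regular-fixedPoint⇒≈ε (c , false) (x , _)     (eq , _) = A.identityˡ-unique c x eq , refl
  regular-fixedPoint⇒≈ε (c , true)  (x , false) (_ , ())
  regular-fixedPoint⇒≈ε (c , true)  (x , true)  (_ , ())

  regular-der : ∀ g → ¬ g ≈ ε → Reg.Der g
  regular-der g g≉ε ω = g≉ε ∘ regular-fixedPoint⇒≈ε g ω

  regular-adjacent : ∀ g h → ¬ g ≈ h → Reg.Der (g ⁻¹ ∙ h)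
  regular-adjacent g h g≉h = regular-der (g ⁻¹ ∙ h) (g≉h ∘ ⁻¹∙≈ε⇒≈ g h)

  reflection : Carrier
  reflection = A.ε , true

  ε≉reflection : ¬ ε ≈ reflection
  ε≉reflection (_ , ())

  regular-singleLabel : Reg.NumLabels (Reg.Dto ε reflection) 1
  regular-singleLabel = singleton-numLabels (regularAction A)
    (regular-der reflection (ε≉reflection ∘ ≈-sym) , ∙-identityʳ reflection)
    (λ g (_ , gε≈x) → ≈-trans (≈-sym (∙-identityʳ g)) gε≈x)

  regular-EKR : Reg.EKR
  regular-EKR eG eΩ =
    1 , ≡.trans (*-identityˡ (size eΩ)) (enumeration-size-unique dihedralSetoid eΩ eG) ,
    clique⇒independenceNumber-1 (regularAction A) {S = Reg.Der} regular-adjacent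

  regular-EKRRobust : Reg.EKRRobust
  regular-EKRRobust = EKR⇒EKRRobust (regularAction A)
    (λ _ _ → singleLabel⇒fewerThanDG-empty (regularAction A) ε≉reflection regular-singleLabel)
    regular-EKR

  ≈H⇒proj₁-≈ : ∀ g h → g ≈H h → proj₁ g A.≈ proj₁ h
  ≈H⇒proj₁-≈ (a , false) (b , _) = x⁻¹∙y≈ε⇒x≈y A.group a b
  ≈H⇒proj₁-≈ (a , true)  (b , _) = A.x∙y⁻¹≈ε⇒x≈y a b

  proj₁-≈⇒≈H : ∀ g h → proj₁ g A.≈ proj₁ h → g ≈H h
  proj₁-≈⇒≈H (a , false) (b , _) = x≈y⇒x⁻¹∙y≈ε A.group
  proj₁-≈⇒≈H (a , true)  (b , _) = A.x≈y⇒x∙y⁻¹≈ε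

  cosetSetoid : Setoid c ℓ
  cosetSetoid = record
    { Carrier       = Carrier
    ; _≈_           = _≈H_
    ; isEquivalence = record
      { refl  = λ {g} → proj₁-≈⇒≈H g g A.refl
      ; sym   = λ {g} {h} g≈h → proj₁-≈⇒≈H h g (A.sym (≈H⇒proj₁-≈ g h g≈h))
      ; trans = λ {g} {h} {k} g≈h h≈k →
          proj₁-≈⇒≈H g k (A.trans (≈H⇒proj₁-≈ g h g≈h) (≈H⇒proj₁-≈ h k h≈k))
      }
    }

  cosetEnumeration : Enumeration A._≈_ → Enumeration _≈H_
  cosetEnumeration e = record
    { elems    = map (_, false) (elems e)
    ; distinct = AllPairs.map⁺
        (AllPairs.map (λ {a} {b} a≉b → a≉b ∘ ≈H⇒proj₁-≈ (a , false) (b , false)) (distinct e))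
    ; complete = λ g → Any.map⁺ (Any.map (λ {b} → proj₁-≈⇒≈H g (b , false)) (complete e (proj₁ g)))
    }

  coset-degree : Enumeration A._≈_ → (eG : Enumeration _≈_) (eΩ : Enumeration _≈H_) →
                 2 * size eΩ ≡ size eG
  coset-degree eA eG eΩ = begin
    2 * size eΩ
      ≡⟨ ≡.cong (2 *_) (enumeration-size-unique cosetSetoid eΩ (cosetEnumeration eA)) ⟩
    2 * length (map (_, false) (elems eA))
      ≡⟨ ≡.cong (2 *_) (length-map _ (elems eA)) ⟩
    2 * size eA
      ≡⟨ size-×-Bool-enumeration A.setoid eA ⟨
    size (×-Bool-enumeration A.setoid eA)
      ≡⟨ enumeration-size-unique dihedralSetoid (×-Bool-enumeration A.setoid eA) eG ⟩
    size eG ∎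
    where open ≡.≡-Reasoning

  rotation-der : ∀ c → ¬ c A.≈ A.ε → Cos.Der (c , false)
  rotation-der c c≉ε (x , u) fixed =
    c≉ε (A.identityˡ-unique c x (≈H⇒proj₁-≈ (c A.∙ x , u) (x , u) fixed))

  coset-adjacent : ∀ g h → proj₂ g ≡ proj₂ h → ¬ g ≈ h → Cos.Der (g ⁻¹ ∙ h)
  coset-adjacent g@(_ , false) h@(_ , false) _ g≉h =
    rotation-der _ λ quotient≈ε → g≉h (⁻¹∙≈ε⇒≈ g h (quotient≈ε , refl))
  coset-adjacent g@(_ , true)  h@(_ , true)  _ g≉h =
    rotation-der _ λ quotient≈ε → g≉h (⁻¹∙≈ε⇒≈ g h (quotient≈ε , refl))
  coset-adjacent (_ , false) (_ , true)  ()
  coset-adjacent (_ , true)  (_ , false) ()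

  squareReflection-notDer : ∀ a c → c A.≈ a A.∙ a → ¬ Cos.Der (c , true)
  squareReflection-notDer a c c≈a² der = der (a , false)
    (proj₁-≈⇒≈H (c A.∙ a A.⁻¹ , true) (a , false)
      (A.trans (A.∙-congʳ c≈a²) (A.cancelʳ (A.inverseʳ a) a)))

  coset-independent : Cos.Independent Cos.Der (ε ∷ reflection ∷ [])
  coset-independent =
      ((ε≉reflection
      , squareReflection-notDer A.ε _ (A.trans (A.inverseˡ A.ε) (A.sym (A.identityʳ A.ε)))
      , squareReflection-notDer A.ε _ (A.trans (A.inverseʳ A.ε) (A.sym (A.identityʳ A.ε)))) ∷ [])
    ∷ [] ∷ []

  coset-EKR : Enumeration A._≈_ → Cos.EKR
  coset-EKR eA eG eΩ =
    2 , coset-degree eA eG eΩ ,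
    twoCliques⇒independenceNumber-2 (cosetAction A) {S = Cos.Der}
      proj₂ coset-adjacent coset-independent

  coset-singleLabel : ∀ a → ¬ a A.∙ a A.≈ A.ε → Cos.NumLabels (Cos.Dto ε (a A.∙ a , false)) 1
  coset-singleLabel a a²≉ε = singleton-numLabels (cosetAction A)
    ( rotation-der (a A.∙ a) a²≉ε
    , proj₁-≈⇒≈H (a A.∙ a A.∙ A.ε , false) (a A.∙ a , false) (A.identityʳ (a A.∙ a)))
    onlyRotation
    where
    moves⇒proj₁≈a² : ∀ g → g ∙ ε ≈H (a A.∙ a , false) → proj₁ g A.≈ a A.∙ a
    moves⇒proj₁≈a² g moves =
      A.trans (A.sym (proj₁ (∙-identityʳ g))) (≈H⇒proj₁-≈ (g ∙ ε) (a A.∙ a , false) moves)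

    onlyRotation : ∀ g → Cos.Dto ε (a A.∙ a , false) g → g ≈ (a A.∙ a , false)
    onlyRotation g@(_ , false) (_ , moves) = moves⇒proj₁≈a² g moves , refl
    onlyRotation g@(c , true) (der , moves) =
      ⊥-elim (squareReflection-notDer a c (moves⇒proj₁≈a² g moves) der)

  -- A nonempty D refutes a² ≉ ε for every a; decidability of ≈ is what turns this into a² ≈ ε.
  coset-fewerThanDG-empty : Decidable A._≈_ → ¬ ElementaryAbelian2 A →
                            ∀ D → Cos.FewerThanDG D → ∀ g → D g ≡ false
  coset-fewerThanDG-empty _≟_ ¬EA D fewer g = ¬-not λ Dg → ¬EA λ a →
    decidable-stable ((a A.∙ a) ≟ A.ε) λ a²≉ε →
      not-¬ (singleLabel⇒fewerThanDG-empty (cosetAction A) {ε} {a A.∙ a , false}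
               (ε≉a² a a²≉ε) (coset-singleLabel a a²≉ε) fewer g) Dg
    where
    ε≉a² : ∀ a → ¬ a A.∙ a A.≈ A.ε → ¬ ε ≈H (a A.∙ a , false)
    ε≉a² a a²≉ε = a²≉ε ∘ A.sym ∘ ≈H⇒proj₁-≈ ε (a A.∙ a , false)

  coset-EKRRobust : Decidable A._≈_ → Enumeration A._≈_ → ¬ ElementaryAbelian2 A → Cos.EKRRobust
  coset-EKRRobust _≟_ eA ¬EA = EKR⇒EKRRobust (cosetAction A)
    (λ D _ → coset-fewerThanDG-empty _≟_ ¬EA D) (coset-EKR eA)

theorem4p2 : ∀ {c ℓ} (A : AbelianGroup c ℓ)
    → Decidable (AbelianGroup._≈_ A)
    → Enumeration (AbelianGroup._≈_ A)
    → ¬ ElementaryAbelian2 A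
    → (ActionNotions.EKR (regularAction A) × ActionNotions.EKRRobust (regularAction A))
      × (ActionNotions.EKR (cosetAction A) × ActionNotions.EKRRobust (cosetAction A))
theorem4p2 A _≟_ eA ¬EA =
    (regular-EKR , regular-EKRRobust)
  , (coset-EKR eA , coset-EKRRobust _≟_ eA ¬EA)
  where open GeneralisedDihedral A
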